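{- For all real numbers $a,b,c>0$, with $x=\frac{1+ac}{b}$, one has the matrix identity $$V(a,b)\,H(b,c)=H(a,x)\,V(x,c).$$
   Context: For nonzero reals $a,b$ define the $2\times 2$ matrices $$H(a,b)=\frac1b\begin{pmatrix} b&0\\ 1&a\end{pmatrix},\qquad V(a,b)=\frac1b\begin{pmatrix} a&1\\ 0&b\end{pmatrix}.$$ -}

module Defs where

open import Level using (Level; _⊔_; suc)
open import Algebra.Bundles using (CommutativeRing)
open import Relation.Nullary using (¬_)
open import Relation.Binary.Core using (Rel)
open import Data.Sum using (_⊎_)

-- An ordered field (the real numbers ℝ are an instance).  Agda's standard
-- library has no reals, so the theorem is stated for every ordered field.
record OrderedField (c ℓ₁ ℓ₂ : Level) : Set (Level.suc (c ⊔ ℓ₁ ⊔ ℓ₂)) where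
  field
    commutativeRing : CommutativeRing c ℓ₁
  open CommutativeRing commutativeRing public
  field
    _<_        : Rel Carrier ℓ₂
    _⁻¹        : Carrier → Carrier
    0≉1        : ¬ (0# ≈ 1#)
    ⁻¹-inverse : ∀ x → ¬ (x ≈ 0#) → (x * (x ⁻¹)) ≈ 1#
    <-resp-≈   : ∀ {x x′ y y′} → x ≈ x′ → y ≈ y′ → x < y → x′ < y′
    <-irrefl   : ∀ {x} → ¬ (x < x)
    <-trans    : ∀ {x y z} → x < y → y < z → x < z
    <-trichot  : ∀ x y → x < y ⊎ (x ≈ y ⊎ y < x)
    +-mono-<   : ∀ {x y} z → x < y → (x + z) < (y + z)
    *-pos      : ∀ {x y} → 0# < x → 0# < y → 0# < (x * y)

record Mat2 {c} (A : Set c) : Set c where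
  constructor mat
  field
    m11 m12 m21 m22 : A

module Matrices {c ℓ₁ ℓ₂} (F : OrderedField c ℓ₁ ℓ₂) where
  open OrderedField F

  _⊗_ : Mat2 Carrier → Mat2 Carrier → Mat2 Carrier
  mat a11 a12 a21 a22 ⊗ mat b11 b12 b21 b22 =
    mat (a11 * b11 + a12 * b21) (a11 * b12 + a12 * b22)
        (a21 * b11 + a22 * b21) (a21 * b12 + a22 * b22)

  _≋_ : Mat2 Carrier → Mat2 Carrier → Set ℓ₁
  mat a11 a12 a21 a22 ≋ mat b11 b12 b21 b22 =
    (a11 ≈ b11) × (a12 ≈ b12) × (a21 ≈ b21) × (a22 ≈ b22)
    where open import Data.Product using (_×_)

  scale : Carrier → Mat2 Carrier → Mat2 Carrier
  scale s (mat a11 a12 a21 a22) = mat (s * a11) (s * a12) (s * a21) (s * a22)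

  -- H(a,b) = (1/b) [[b,0],[1,a]],   V(a,b) = (1/b) [[a,1],[0,b]]
  -- (only meaningful for b ≠ 0, which is always the case where used)
  H : Carrier → Carrier → Mat2 Carrier
  H a b = scale (b ⁻¹) (mat b 0# 1# a)

  V : Carrier → Carrier → Mat2 Carrier
  V a b = scale (b ⁻¹) (mat a 1# 0# b)

-- Write B = b⁻¹, C = c⁻¹, X = x⁻¹.  Multiplying out,
--   V(a,b) H(b,c) = (BC) [[1 + ac, b], [b, b²]],
--   H(a,x) V(x,c) = (XC) [[x², x], [x, 1 + ac]].
-- Under the single relation  b·x = 1 + ac  both products equal the common
-- matrix  C [[x, 1], [1, b]]: the first needs only b·B = 1, the second only
-- x·X = 1.
module Submission where

open import Defs
open import Data.Product using (_,_)
open import Data.Sum using (inj₁; inj₂)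
open import Data.Empty using (⊥-elim)
open import Relation.Nullary using (¬_)

module Exchange {c ℓ₁ ℓ₂} (F : OrderedField c ℓ₁ ℓ₂) where
  open OrderedField F
  open Matrices F
  open import Algebra.Properties.Ring ring using (-1*x≈-x; -‿involutive)
  open import Algebra.Solver.Ring.NaturalCoefficients.Default commutativeSemiring
  open import Relation.Binary.Reasoning.Setoid setoid

  pos⇒≉0 : ∀ {y} → 0# < y → ¬ (y ≈ 0#)
  pos⇒≉0 0<y y≈0 = <-irrefl (<-resp-≈ refl y≈0 0<y)

  -- 1 is positive: otherwise -1 > 0, and then 1 = (-1)(-1) > 0 anyway.
  0<1 : 0# < 1#
  0<1 with <-trichot 0# 1#
  ... | inj₁ 0<1′         = 0<1′
  ... | inj₂ (inj₁ 0≈1)   = ⊥-elim (0≉1 0≈1)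
  ... | inj₂ (inj₂ 1<0)   = ⊥-elim (<-irrefl (<-trans 1<0 0<1′))
    where
    0<-1 : 0# < (- 1#)
    0<-1 = <-resp-≈ (-‿inverseʳ 1#) (+-identityˡ (- 1#)) (+-mono-< (- 1#) 1<0)

    0<1′ : 0# < 1#
    0<1′ = <-resp-≈ refl (trans (-1*x≈-x (- 1#)) (-‿involutive 1#)) (*-pos 0<-1 0<-1)

  0<1+ : ∀ {y} → 0# < y → 0# < (1# + y)
  0<1+ {y} 0<y = <-trans 0<1 (<-resp-≈ (+-identityˡ 1#) (+-comm y 1#) (+-mono-< 1# 0<y))

  *-≉0ʳ : ∀ u v → ¬ (u * v ≈ 0#) → ¬ (v ≈ 0#)
  *-≉0ʳ u v uv≉0 v≈0 = uv≉0 (trans (*-congˡ v≈0) (zeroʳ u))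

  cancel : ∀ {u v} → u * v ≈ 1# → ∀ w → w * (u * v) ≈ w
  cancel uv≈1 w = trans (*-congˡ uv≈1) (*-identityʳ w)

  common : Carrier → Carrier → Carrier → Mat2 Carrier
  common x b c = scale (c ⁻¹) (mat x 1# 1# b)

  VH-product : ∀ a b c x → b * b ⁻¹ ≈ 1# → b * x ≈ 1# + a * c →
               (V a b ⊗ H b c) ≋ common x b c
  VH-product a b c x bB≈1 bx≈1+ac = e₁₁ , e₁₂ , e₂₁ , e₂₂
    where
    B = b ⁻¹
    C = c ⁻¹

    e₁₁ : B * a * (C * c) + B * 1# * (C * 1#) ≈ C * x
    e₁₁ = begin
      B * a * (C * c) + B * 1# * (C * 1#)
        ≈⟨ solve 4 (λ a c B C → B :* a :* (C :* c) :+ B :* con 1 :* (C :* con 1)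
                               := C :* B :* (con 1 :+ a :* c)) refl a c B C ⟩
      C * B * (1# + a * c)  ≈⟨ *-congˡ (sym bx≈1+ac) ⟩
      C * B * (b * x)       ≈⟨ solve 4 (λ b x B C → C :* B :* (b :* x) := C :* x :* (b :* B)) refl b x B C ⟩
      C * x * (b * B)       ≈⟨ cancel bB≈1 (C * x) ⟩
      C * x                 ∎

    e₁₂ : B * a * (C * 0#) + B * 1# * (C * b) ≈ C * 1#
    e₁₂ = begin
      B * a * (C * 0#) + B * 1# * (C * b)
        ≈⟨ solve 4 (λ a b B C → B :* a :* (C :* con 0) :+ B :* con 1 :* (C :* b)
                               := C :* (b :* B)) refl a b B C ⟩
      C * (b * B)  ≈⟨ *-congˡ bB≈1 ⟩
      C * 1#       ∎

    e₂₁ : B * 0# * (C * c) + B * b * (C * 1#) ≈ C * 1#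
    e₂₁ = begin
      B * 0# * (C * c) + B * b * (C * 1#)
        ≈⟨ solve 4 (λ b c B C → B :* con 0 :* (C :* c) :+ B :* b :* (C :* con 1)
                               := C :* (b :* B)) refl b c B C ⟩
      C * (b * B)  ≈⟨ *-congˡ bB≈1 ⟩
      C * 1#       ∎

    e₂₂ : B * 0# * (C * 0#) + B * b * (C * b) ≈ C * b
    e₂₂ = begin
      B * 0# * (C * 0#) + B * b * (C * b)
        ≈⟨ solve 3 (λ b B C → B :* con 0 :* (C :* con 0) :+ B :* b :* (C :* b)
                             := C :* b :* (b :* B)) refl b B C ⟩
      C * b * (b * B)  ≈⟨ cancel bB≈1 (C * b) ⟩
      C * b            ∎

  HV-product : ∀ a b c x → x * x ⁻¹ ≈ 1# → b * x ≈ 1# + a * c →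
               (H a x ⊗ V x c) ≋ common x b c
  HV-product a b c x xX≈1 bx≈1+ac = e₁₁ , e₁₂ , e₂₁ , e₂₂
    where
    X = x ⁻¹
    C = c ⁻¹

    e₁₁ : X * x * (C * x) + X * 0# * (C * 0#) ≈ C * x
    e₁₁ = begin
      X * x * (C * x) + X * 0# * (C * 0#)
        ≈⟨ solve 3 (λ x X C → X :* x :* (C :* x) :+ X :* con 0 :* (C :* con 0)
                             := C :* x :* (x :* X)) refl x X C ⟩
      C * x * (x * X)  ≈⟨ cancel xX≈1 (C * x) ⟩
      C * x            ∎

    e₁₂ : X * x * (C * 1#) + X * 0# * (C * c) ≈ C * 1#
    e₁₂ = begin
      X * x * (C * 1#) + X * 0# * (C * c)
        ≈⟨ solve 4 (λ c x X C → X :* x :* (C :* con 1) :+ X :* con 0 :* (C :* c)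
                               := C :* (x :* X)) refl c x X C ⟩
      C * (x * X)  ≈⟨ *-congˡ xX≈1 ⟩
      C * 1#       ∎

    e₂₁ : X * 1# * (C * x) + X * a * (C * 0#) ≈ C * 1#
    e₂₁ = begin
      X * 1# * (C * x) + X * a * (C * 0#)
        ≈⟨ solve 4 (λ a x X C → X :* con 1 :* (C :* x) :+ X :* a :* (C :* con 0)
                               := C :* (x :* X)) refl a x X C ⟩
      C * (x * X)  ≈⟨ *-congˡ xX≈1 ⟩
      C * 1#       ∎

    e₂₂ : X * 1# * (C * 1#) + X * a * (C * c) ≈ C * b
    e₂₂ = begin
      X * 1# * (C * 1#) + X * a * (C * c)
        ≈⟨ solve 4 (λ a c X C → X :* con 1 :* (C :* con 1) :+ X :* a :* (C :* c)
                               := C :* X :* (con 1 :+ a :* c)) refl a c X C ⟩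
      C * X * (1# + a * c)  ≈⟨ *-congˡ (sym bx≈1+ac) ⟩
      C * X * (b * x)       ≈⟨ solve 4 (λ b x X C → C :* X :* (b :* x) := C :* b :* (x :* X)) refl b x X C ⟩
      C * b * (x * X)       ≈⟨ cancel xX≈1 (C * b) ⟩
      C * b                 ∎

  ≋-sym : ∀ {M N} → M ≋ N → N ≋ M
  ≋-sym {mat _ _ _ _} {mat _ _ _ _} (p , q , r , s) = sym p , sym q , sym r , sym s

  ≋-trans : ∀ {L M N} → L ≋ M → M ≋ N → L ≋ N
  ≋-trans {mat _ _ _ _} {mat _ _ _ _} {mat _ _ _ _} (p , q , r , s) (p′ , q′ , r′ , s′) =
    trans p p′ , trans q q′ , trans r r′ , trans s s′

  b*[y*b⁻¹]≈y : ∀ b y → b * b ⁻¹ ≈ 1# → b * (y * b ⁻¹) ≈ y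
  b*[y*b⁻¹]≈y b y bB≈1 = begin
    b * (y * b ⁻¹)  ≈⟨ solve 3 (λ b y B → b :* (y :* B) := y :* (b :* B)) refl b y (b ⁻¹) ⟩
    y * (b * b ⁻¹)  ≈⟨ cancel bB≈1 y ⟩
    y               ∎

  exchange : ∀ a b c → 0# < a → 0# < b → 0# < c →
             let x = (1# + a * c) * (b ⁻¹) in
             (V a b ⊗ H b c) ≋ (H a x ⊗ V x c)
  exchange a b c 0<a 0<b 0<c =
    ≋-trans (VH-product a b c x bB≈1 bx≈1+ac) (≋-sym (HV-product a b c x xX≈1 bx≈1+ac))
    where
    x = (1# + a * c) * (b ⁻¹)

    bB≈1 : b * b ⁻¹ ≈ 1#
    bB≈1 = ⁻¹-inverse b (pos⇒≉0 0<b)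

    bx≈1+ac : b * x ≈ 1# + a * c
    bx≈1+ac = b*[y*b⁻¹]≈y b (1# + a * c) bB≈1

    -- x ≠ 0 because b·x = 1 + ac > 0.
    bx≉0 : ¬ (b * x ≈ 0#)
    bx≉0 bx≈0 = pos⇒≉0 (0<1+ (*-pos 0<a 0<c)) (trans (sym bx≈1+ac) bx≈0)

    xX≈1 : x * x ⁻¹ ≈ 1#
    xX≈1 = ⁻¹-inverse x (*-≉0ʳ b x bx≉0)

mainTheorem1 : ∀ {c ℓ₁ ℓ₂} (F : OrderedField c ℓ₁ ℓ₂) →
    let open OrderedField F
        open Matrices F
    in ∀ a b c → 0# < a → 0# < b → 0# < c →
      let x = (1# + a * c) * (b ⁻¹) in
      (V a b ⊗ H b c) ≋ (H a x ⊗ V x c)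
mainTheorem1 F = Exchange.exchange F
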